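{- Let $p=5$ and $f(x)=x^8+x^6+x^2$, and write $E(\pi x^8)E(\pi x^6)E(\pi x^2)=\sum_{i\ge0}F_i(\pi)x^i$ with $F_i(\pi)\in\mathbb{Z}_5[\pi]$. Then for $i\ge0$, \[ \mathrm{ord}_\pi F_i(\pi)\ \ge\ \begin{cases}\lceil i/8\rceil & i\text{ even},\ i\neq4,\\ 2 & i=4,\\ \infty & i \text{ odd}.\end{cases} \]
   Context: $E(x)=\exp\big(\sum_{i\ge0}x^{p^i}/p^i\big)\in\mathbb{Z}_p[[x]]$ is the Artin–Hasse exponential, $\pi$ is a formal variable, and $\mathrm{ord}_\pi$ denotes the $\pi$-adic order (lowest degree in $\pi$ with nonzero coefficient; $\infty$ for the zero polynomial). -}

module Defs where

open import Data.Nat as ℕ using (ℕ; zero; suc; _∸_; _^_; _!; _≡ᵇ_; _<_; NonZero)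
open import Data.Nat.Properties using (m^n≢0; _!≢0)
open import Data.Bool using (if_then_else_)
open import Data.Integer using (+_)
open import Data.Rational using (ℚ; 0ℚ; 1ℚ; _+_; _*_; _/_)
open import Relation.Binary.PropositionalEquality using (_≡_)

sumTo : ℕ → (ℕ → ℚ) → ℚ
sumTo zero    f = f 0
sumTo (suc n) f = sumTo n f + f (suc n)

Series : Set
Series = ℕ → ℚ

_⊛_ : Series → Series → Series
(f ⊛ g) k = sumTo k (λ j → f j * g (k ∸ j))

one : Series
one zero    = 1ℚ
one (suc _) = 0ℚ

pow : Series → ℕ → Series
pow g zero    = one
pow g (suc n) = g ⊛ pow g n

-- exp(g) for a series g with zero constant term:
-- coefficient k of Σ_n g^n / n!; only n ≤ k contribute since ord g ≥ 1.
expS : Series → Series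
expS g k = sumTo k (λ n → pow g n k * _/_ (+ 1) (n !) ⦃ n !≢0 ⦄)

-- The series Σ_{i≥0} x^{p^i}/p^i : coefficient k is 1/p^i if k = p^i, else 0.
-- (only i ≤ k can satisfy p^i = k when p ≥ 2)
ahLog : (p : ℕ) → ⦃ NonZero p ⦄ → Series
ahLog p k = sumTo k (λ i → if (p ^ i) ≡ᵇ k then _/_ (+ 1) (p ^ i) ⦃ m^n≢0 p i ⦄ else 0ℚ)

-- Artin–Hasse exponential E(x) = exp(Σ_i x^{p^i}/p^i), coefficients in ℚ
-- (they lie in ℤ_(p) ⊂ ℤ_p).
AH : (p : ℕ) → ⦃ NonZero p ⦄ → Series
AH p = expS (ahLog p)

-- Power series in x with coefficients polynomials in π:
-- B i n = coefficient of x^i π^n.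
BiSeries : Set
BiSeries = ℕ → ℕ → ℚ

_⊛₂_ : BiSeries → BiSeries → BiSeries
(A ⊛₂ B) i n = sumTo i (λ j → sumTo n (λ m → A j m * B (i ∸ j) (n ∸ m)))

-- E(π x^d) = Σ_n e_n π^n x^{d n}
AHsubst : (p : ℕ) → ⦃ NonZero p ⦄ → ℕ → BiSeries
AHsubst p d i n = if i ≡ᵇ (d ℕ.* n) then AH p n else 0ℚ

-- F i n = coefficient of π^n in F_i(π), where
-- E(π x^8) E(π x^6) E(π x^2) = Σ_i F_i(π) x^i, p = 5.
F : ℕ → ℕ → ℚ
F = (AHsubst 5 8 ⊛₂ AHsubst 5 6) ⊛₂ AHsubst 5 2

OrdGe : (ℕ → ℚ) → ℕ → Set
OrdGe P m = ∀ n → n < m → P n ≡ 0ℚ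

OrdInfty : (ℕ → ℚ) → Set
OrdInfty P = ∀ n → P n ≡ 0ℚ

{-# OPTIONS --safe #-}
-- Expanding the product, F_i(π) is a sum of terms e_a e_b e_c π^(a+b+c) over all
-- (a, b, c) with 8a + 6b + 2c = i, where e_n are the coefficients of E.  Hence a
-- nonzero coefficient of π^n in F_i forces i = 8a + 6b + 2c with n = a + b + c:
-- then i is even, i ≤ 8n, and i = 4 is only reached with (a, b, c) = (0, 0, 2).
module Submission where

open import Defs
open import Data.Nat using (ℕ; _+_; _/_; _%_)
open import Data.Product using (_×_)
open import Relation.Binary.PropositionalEquality using (_≡_; _≢_)

open import Data.Nat using (zero; suc; _*_; _∸_; _≤_; _≡ᵇ_; s≤s; z≤n; NonZero)
open import Data.Nat.Properties
  using (≡ᵇ⇒≡; m+[n∸m]≡n; ≤-refl; ≤-trans; ≤-reflexive; n≤1+n; ≤-pred; m≤m+n; <⇒≱; 0≢1+n;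
         +-comm; +-mono-≤; +-monoˡ-≤; *-comm; *-monoʳ-≤; *-distribʳ-+)
open import Data.Nat.DivMod using (m<n*o⇒m/o<n)
open import Data.Nat.Divisibility using (_∣_; divides; ∣-trans; n∣m*n; ∣m∣n⇒∣m+n; n∣m⇒m%n≡0)
open import Data.Rational using (ℚ; 0ℚ) renaming (_+_ to _+ℚ_; _*_ to _*ℚ_)
open import Data.Rational.Properties using (_≟_; +-identityʳ; *-zeroˡ; *-zeroʳ)
open import Data.Product using (∃-syntax; _,_)
open import Data.Bool using (true; false; T)
open import Data.Empty using (⊥-elim)
open import Relation.Nullary using (¬_; yes; no)
open import Relation.Nullary.Decidable using (decidable-stable)
open import Relation.Binary.PropositionalEquality using (refl; sym; trans; cong; cong₂; subst)

sumTo-support : ∀ k (f : ℕ → ℚ) → sumTo k f ≢ 0ℚ → ∃[ j ] j ≤ k × f j ≢ 0ℚ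
sumTo-support zero    f f0≢0 = 0 , z≤n , f0≢0
sumTo-support (suc k) f sum≢0 with f (suc k) ≟ 0ℚ
... | no fk≢0 = suc k , ≤-refl , fk≢0
... | yes fk≡0 with sumTo-support k f (λ s≡0 → sum≢0 (trans (cong₂ _+ℚ_ s≡0 fk≡0) (+-identityʳ 0ℚ)))
...   | j , j≤k , fj≢0 = j , ≤-trans j≤k (n≤1+n k) , fj≢0

*-nonzero : ∀ x y → x *ℚ y ≢ 0ℚ → x ≢ 0ℚ × y ≢ 0ℚ
*-nonzero x y xy≢0 = (λ x≡0 → xy≢0 (trans (cong (_*ℚ y) x≡0) (*-zeroˡ y)))
                   , (λ y≡0 → xy≢0 (trans (cong (x *ℚ_) y≡0) (*-zeroʳ x)))

⊛₂-support : ∀ (A B : BiSeries) {i n} → (A ⊛₂ B) i n ≢ 0ℚ →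
  ∃[ j ] ∃[ m ] j ≤ i × m ≤ n × A j m ≢ 0ℚ × B (i ∸ j) (n ∸ m) ≢ 0ℚ
⊛₂-support A B {i} {n} AB≢0
  with sumTo-support i (λ j → sumTo n (λ m → A j m *ℚ B (i ∸ j) (n ∸ m))) AB≢0
... | j , j≤i , row≢0 with sumTo-support n (λ m → A j m *ℚ B (i ∸ j) (n ∸ m)) row≢0
...   | m , m≤n , term≢0 with *-nonzero (A j m) (B (i ∸ j) (n ∸ m)) term≢0
...     | Ajm≢0 , B≢0 = j , m , j≤i , m≤n , Ajm≢0 , B≢0

SupportedOn : ℕ → BiSeries → Set
SupportedOn d A = ∀ i n → A i n ≢ 0ℚ → i ≡ n * d

AHsubst-supportedOn : ∀ p ⦃ _ : NonZero p ⦄ d → SupportedOn d (AHsubst p d)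
AHsubst-supportedOn p d i n ≢0 with i ≡ᵇ d * n in eq
... | true  = trans (≡ᵇ⇒≡ i (d * n) (subst T (sym eq) _)) (*-comm d n)
... | false = ⊥-elim (≢0 refl)

-- (π x^d₁)^a (π x^d₂)^b (π x^d₃)^c = x^i π^n.
record Monomial (d₁ d₂ d₃ i n : ℕ) : Set where
  field
    a b c    : ℕ
    x-degree : i ≡ a * d₁ + b * d₂ + c * d₃
    π-degree : n ≡ a + b + c

⊛₂-monomial : ∀ {d₁ d₂ d₃} {A B C : BiSeries} →
  SupportedOn d₁ A → SupportedOn d₂ B → SupportedOn d₃ C →
  ∀ {i n} → ((A ⊛₂ B) ⊛₂ C) i n ≢ 0ℚ → Monomial d₁ d₂ d₃ i n
⊛₂-monomial {A = A} {B} {C} suppA suppB suppC {i} {n} ABC≢0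
  with ⊛₂-support (A ⊛₂ B) C ABC≢0
... | j , m , j≤i , m≤n , AB≢0 , C≢0 with ⊛₂-support A B AB≢0
...   | j′ , m′ , j′≤j , m′≤m , A≢0 , B≢0 = record
  { a = m′ ; b = m ∸ m′ ; c = n ∸ m
  ; x-degree = trans (split j≤i)
      (cong₂ _+_ (trans (split j′≤j) (cong₂ _+_ (suppA _ _ A≢0) (suppB _ _ B≢0))) (suppC _ _ C≢0))
  ; π-degree = trans (split m≤n) (cong (_+ (n ∸ m)) (split m′≤m))
  }
  where
  split : ∀ {k l} → k ≤ l → l ≡ k + (l ∸ k)
  split k≤l = sym (m+[n∸m]≡n k≤l)

monomial-∣ : ∀ {d₁ d₂ d₃ i n e} → Monomial d₁ d₂ d₃ i n → e ∣ d₁ → e ∣ d₂ → e ∣ d₃ → e ∣ i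
monomial-∣ {d₁} {d₂} {d₃} M e∣d₁ e∣d₂ e∣d₃ rewrite Monomial.x-degree M =
  ∣m∣n⇒∣m+n (∣m∣n⇒∣m+n (∣-trans e∣d₁ (n∣m*n a {d₁})) (∣-trans e∣d₂ (n∣m*n b {d₂})))
            (∣-trans e∣d₃ (n∣m*n c {d₃}))
  where open Monomial M

monomial-≤ : ∀ {d₁ d₂ d₃ i n d} → Monomial d₁ d₂ d₃ i n → d₁ ≤ d → d₂ ≤ d → d₃ ≤ d → i ≤ n * d
monomial-≤ {d₁} {d₂} {d₃} {d = d} M d₁≤d d₂≤d d₃≤d rewrite Monomial.x-degree M | Monomial.π-degree M =
  subst (a * d₁ + b * d₂ + c * d₃ ≤_)
        (sym (trans (*-distribʳ-+ d (a + b) c) (cong (_+ c * d) (*-distribʳ-+ d a b))))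
    (+-mono-≤ (+-mono-≤ (*-monoʳ-≤ a d₁≤d) (*-monoʳ-≤ b d₂≤d)) (*-monoʳ-≤ c d₃≤d))
  where open Monomial M

monomial-8-6-2-of-4 : ∀ {n} → Monomial 8 6 2 4 n → 2 ≤ n
monomial-8-6-2-of-4 record { a = zero ; b = zero ; c = suc (suc c) ; π-degree = refl } = s≤s (s≤s z≤n)
monomial-8-6-2-of-4 record { a = zero ; b = zero ; c = suc zero ; x-degree = () }
monomial-8-6-2-of-4 record { a = zero ; b = zero ; c = zero ; x-degree = () }
monomial-8-6-2-of-4 record { a = zero ; b = suc b ; x-degree = () }
monomial-8-6-2-of-4 record { a = suc a ; x-degree = () }

⌈/⌉-≤ : ∀ {i n} k → i ≤ n * suc k → (i + k) / suc k ≤ n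
⌈/⌉-≤ {n = n} k i≤ns =
  ≤-pred (m<n*o⇒m/o<n (s≤s (≤-trans (+-monoˡ-≤ k i≤ns) (≤-reflexive (+-comm (n * suc k) k)))))

F-support : ∀ {i n} → F i n ≢ 0ℚ → Monomial 8 6 2 i n
F-support = ⊛₂-monomial {A = AHsubst 5 8} {AHsubst 5 6} {AHsubst 5 2}
  (AHsubst-supportedOn 5 8) (AHsubst-supportedOn 5 6) (AHsubst-supportedOn 5 2)

F-vanishes : ∀ {i n} → ¬ Monomial 8 6 2 i n → F i n ≡ 0ℚ
F-vanishes {i} {n} ¬M = decidable-stable (F i n ≟ 0ℚ) (λ Fin≢0 → ¬M (F-support Fin≢0))

lemma4p3 : ∀ (i : ℕ) →
    (i % 2 ≡ 0 → i ≢ 4 → OrdGe (F i) ((i + 7) / 8)) ×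
    (i ≡ 4 → OrdGe (F i) 2) ×
    (i % 2 ≡ 1 → OrdInfty (F i))
lemma4p3 i = even-bound , four-bound , odd-vanishes
  where
  even-bound : i % 2 ≡ 0 → i ≢ 4 → OrdGe (F i) ((i + 7) / 8)
  even-bound _ _ n n<⌈i/8⌉ = F-vanishes λ M →
    <⇒≱ n<⌈i/8⌉ (⌈/⌉-≤ 7 (monomial-≤ {8} {6} {2} {i} {n} {8} M ≤-refl (m≤m+n 6 2) (m≤m+n 2 6)))
  four-bound : i ≡ 4 → OrdGe (F i) 2
  four-bound refl n n<2 = F-vanishes λ M → <⇒≱ n<2 (monomial-8-6-2-of-4 M)
  odd-vanishes : i % 2 ≡ 1 → OrdInfty (F i)
  odd-vanishes i-odd n = F-vanishes {i} {n} λ M →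
    let 2∣i = monomial-∣ M (divides 4 refl) (divides 3 refl) (divides 1 refl)
    in 0≢1+n (trans (sym (n∣m⇒m%n≡0 i 2 2∣i)) i-odd)
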